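{- Let $\mathcal{A}_{\mathbf S}$ be an almost transitive deformation of the braid arrangement in $\mathbb{R}^n$ and let $T\in\mathcal{T}^{(m)}(n)$. Suppose there exist positive integers $a,b,c$ and nodes $u_1,\dots,u_{a+b+c}$ of $T$ such that both $(u_1,u_2,\dots,u_{a+b})$ and $(u_a,u_{a+1},\dots,u_{a+b+c})$ are maximal $\mathbf S$-cadet sequences of $T$. Then $1\in\{u_{a-1},u_{a+b+1}\}$.
   Context: A deformation of the braid arrangement in $\mathbb{R}^n$ is a finite set $\mathcal{A}$ of hyperplanes $x_i-x_j=s$ ($1\le i<j\le n$, $s\in\mathbb{Z}$), encoded by $\mathbf S=(S_{i,j})_{i<j}$, $S_{i,j}=\{s:(x_i-x_j=s)\in\mathcal{A}\}$, written $\mathcal{A}_{\mathbf S}$. For $i<j$: $S^-_{i,j}:=\{s\ge0:-s\in S_{i,j}\}$, $S^-_{j,i}:=\{0\}\cup\{s>0:s\in S_{i,j}\}$. $m=\max\{|s|:s\in\bigcup S_{i,j}\}$. $\mathcal{A}_{\mathbf S}$ is almost transitive if for all distinct $i,j,k\in[n]$ with $1\notin\{i,k\}$ and all nonnegative integers $s\notin S^-_{i,j}$, $t\notin S^-_{j,k}$, we have $s+t\notin S^-_{i,k}$. $\mathcal{T}^{(m)}(n)$: rooted plane trees whose vertices are nodes (exactly $m+1$ ordered children) or leaves, with $n$ nodes labeled bijectively by $1,\dots,n$. $\mathsf{cadet}(u)$: rightmost child of node $u$ that is a node, if any. $\mathsf{lsib}(v)$: number of children of the parent of $v$ to the left of $v$.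 A cadet sequence is a sequence of nodes $(v_1,\dots,v_k)$ with $v_p=\mathsf{cadet}(v_{p-1})$; it is an $\mathbf S$-cadet sequence if $\sum_{p=i+1}^{j}\mathsf{lsib}(v_p)\notin S^-_{v_i,v_j}$ for all $i<j$. A cadet sequence $(v_1,\dots,v_k)$ is maximal if $v_k$ has no cadet and $v_1$ is not the cadet of any node. An $\mathbf S$-cadet sequence $(v_i,\dots,v_j)$ inside the maximal cadet sequence $(v_1,\dots,v_k)$ is a maximal $\mathbf S$-cadet sequence if (a) $i=1$ or $(v_{i-1},\dots,v_j)$ is not $\mathbf S$-cadet, and (b) $j=k$ or $(v_i,\dots,v_{j+1})$ is not $\mathbf S$-cadet. Here $u_{a-1}$ and $u_{a+b+1}$ refer to the nodes adjacent in the ambient maximal cadet sequence (so $u_{a+b+1}$ is the node with index $a+b+1$ in the list). -}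

module Defs where

open import Data.Nat using (ℕ; zero; suc; _+_; _∸_; _≤_; _<_; _⊔_; _<ᵇ_; _≡ᵇ_)
open import Data.Integer using (ℤ; +_; -_; ∣_∣)
open import Data.Bool using (Bool; true; false; if_then_else_)
open import Data.List using (List; []; _∷_; _++_; map; concatMap; foldr; upTo; head; last; [_])
open import Data.List.Membership.Propositional using (_∈_)
open import Data.List.Relation.Unary.All using (All)
open import Data.List.Relation.Unary.Linked using (Linked)
open import Data.List.Relation.Binary.Permutation.Propositional using (_↭_)
open import Data.Maybe using (Maybe; just; nothing; _<∣>_; fromMaybe)
open import Data.Vec using (Vec; []; _∷_)
open import Data.Product using (Σ; _×_; _,_)
open import Data.Sum using (_⊎_)
open import Data.Unit using (⊤)
open import Data.Empty using (⊥)
open import Relation.Nullary using (¬_)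
open import Relation.Binary.PropositionalEquality using (_≡_; _≢_)

-- Deformations of the braid arrangement.
-- S i j (for 1 ≤ i < j ≤ n) is the finite set S_{i,j} ⊆ ℤ, given as a list.
-- Values S i j with i ≥ j or outside [n] are ignored by all definitions.

Family : Set
Family = ℕ → ℕ → List ℤ

range1 : ℕ → List ℕ
range1 n = map suc (upTo n)

range : ℕ → ℕ → List ℕ
range i j = map (λ k → i + k) (upTo (suc j ∸ i))

-- m = max { |s| : s ∈ ⋃_{1≤i<j≤n} S_{i,j} }  (0 if empty)
mOf : ℕ → Family → ℕ
mOf n S = foldr _⊔_ 0
  (concatMap (λ i → concatMap (λ j → if i <ᵇ j then map ∣_∣ (S i j) else []) (range1 n)) (range1 n))

-- S^-_{i,j} as a predicate on ℕ:
--   i < j : { s ≥ 0 : -s ∈ S_{i,j} }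
--   j < i : {0} ∪ { s > 0 : s ∈ S_{j,i} }
--   i = j : never used (empty)
SMinus' : Family → ℕ → ℕ → Bool → Bool → ℕ → Set
SMinus' S i j true  _     s = (- (+ s)) ∈ S i j
SMinus' S i j false true  s = (s ≡ 0) ⊎ ((0 < s) × ((+ s) ∈ S j i))
SMinus' S i j false false s = ⊥

SMinus : Family → ℕ → ℕ → ℕ → Set
SMinus S i j s = SMinus' S i j (i <ᵇ j) (j <ᵇ i) s

InRange : ℕ → ℕ → Set
InRange n i = (1 ≤ i) × (i ≤ n)

AlmostTransitive : ℕ → Family → Set
AlmostTransitive n S =
  ∀ i j k → InRange n i → InRange n j → InRange n k →
  i ≢ j → j ≢ k → i ≢ k → i ≢ 1 → k ≢ 1 →
  ∀ (s t : ℕ) → ¬ SMinus S i j s → ¬ SMinus S j k t → ¬ SMinus S i k (s + t)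

-- Rooted plane trees whose nodes have exactly m+1 ordered children.
-- A node carries its label (a natural number).

data Tree (m : ℕ) : Set where
  leaf : Tree m
  node : ℕ → Vec (Tree m) (suc m) → Tree m

module _ {m : ℕ} where

  labels  : Tree m → List ℕ
  labelsV : {k : ℕ} → Vec (Tree m) k → List ℕ
  labels leaf        = []
  labels (node x cs) = x ∷ labelsV cs
  labelsV []       = []
  labelsV (t ∷ ts) = labels t ++ labelsV ts

  rootLabel : Tree m → Maybe ℕ
  rootLabel leaf       = nothing
  rootLabel (node x _) = just x

  rightmostNode : {k : ℕ} → Vec (Tree m) k → Maybe ℕ
  rightmostNode []       = nothing
  rightmostNode (t ∷ ts) = rightmostNode ts <∣> rootLabel t

  cadet  : Tree m → ℕ → Maybe ℕ
  cadetV : {k : ℕ} → Vec (Tree m) k → ℕ → Maybe ℕ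
  cadet leaf        u = nothing
  cadet (node x cs) u = if x ≡ᵇ u then rightmostNode cs else cadetV cs u
  cadetV []       u = nothing
  cadetV (t ∷ ts) u = cadet t u <∣> cadetV ts u

  rootIs : Tree m → ℕ → Bool
  rootIs leaf       v = false
  rootIs (node x _) v = x ≡ᵇ v

  posIn : {k : ℕ} → ℕ → Vec (Tree m) k → ℕ → Maybe ℕ
  posIn i []       v = nothing
  posIn i (t ∷ ts) v = (if rootIs t v then just i else nothing) <∣> posIn (suc i) ts v

  -- lsib(v): number of children of the parent of v to the left of v
  lsibM  : Tree m → ℕ → Maybe ℕ
  lsibMV : {k : ℕ} → Vec (Tree m) k → ℕ → Maybe ℕ
  lsibM leaf        v = nothing
  lsibM (node x cs) v = posIn 0 cs v <∣> lsibMV cs v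
  lsibMV []       v = nothing
  lsibMV (t ∷ ts) v = lsibM t v <∣> lsibMV ts v

  -- only ever applied to non-root nodes (elements v_p, p ≥ 2, of cadet sequences)
  lsib : Tree m → ℕ → ℕ
  lsib T v = fromMaybe 0 (lsibM T v)

-- T ∈ T^(m)(n): the n nodes are labelled bijectively by 1,…,n
LabelledBy : {m : ℕ} → ℕ → Tree m → Set
LabelledBy n T = labels T ↭ range1 n

module _ {m : ℕ} (S : Family) (T : Tree m) where

  IsCadetSeq : List ℕ → Set
  IsCadetSeq vs = (vs ≢ []) × All (_∈ labels T) vs × Linked (λ x y → cadet T x ≡ just y) vs

  -- for fixed v_i: ∑_{p=i+1}^{j} lsib(v_p) ∉ S^-_{v_i,v_j} for every later v_j
  goodFrom : ℕ → ℕ → List ℕ → Set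
  goodFrom v acc []       = ⊤
  goodFrom v acc (w ∷ ws) = ¬ SMinus S v w (acc + lsib T w) × goodFrom v (acc + lsib T w) ws

  SCond : List ℕ → Set
  SCond []       = ⊤
  SCond (v ∷ vs) = goodFrom v 0 vs × SCond vs

  IsSCadetSeq : List ℕ → Set
  IsSCadetSeq vs = IsCadetSeq vs × SCond vs

  -- maximal S-cadet sequence inside its ambient maximal cadet sequence
  IsMaxSCadetSeq : List ℕ → Set
  IsMaxSCadetSeq vs =
    IsSCadetSeq vs ×
    -- (a) v_i is first in the ambient sequence, or prepending its predecessor breaks S-cadet
    (∀ h → head vs ≡ just h →
       (∀ w → cadet T w ≢ just h) ⊎
       Σ ℕ (λ w → (cadet T w ≡ just h) × ¬ IsSCadetSeq (w ∷ vs))) ×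
    -- (b) v_j is last in the ambient sequence, or appending its cadet breaks S-cadet
    (∀ l → last vs ≡ just l →
       (cadet T l ≡ nothing) ⊎
       Σ ℕ (λ v → (cadet T l ≡ just v) × ¬ IsSCadetSeq (vs ++ [ v ])))

seg : (ℕ → ℕ) → ℕ → ℕ → List ℕ
seg u i j = map u (range i j)

-- Both sequences are cadet chains, so u 1, …, u (a + b + c) is a single downward path in the tree
-- and its labels are distinct. Every pair of positions inside one of the two sequences is
-- compatible (its lsib-sum avoids S⁻), and almost transitivity, applied through a position of the
-- overlap u a, …, u (a + b), makes a pair straddling the overlap compatible as long as neither end
-- is labelled 1. Hence, if 1 occurs among u 1, …, u (a - 2) but not at u (a - 1), then
-- u (a - 1), …, u (a + b + c) is S-cadet; as a node is the cadet of at most one node, this breaks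
-- the maximality of the second sequence at its start. If 1 occurs neither among u 1, …, u (a - 1)
-- nor at u (a + b + 1), then u 1, …, u (a + b + 1) is S-cadet, breaking the maximality of the
-- first sequence at its end.

{-# OPTIONS --safe #-}
module Submission where

open import Defs
open import Data.Bool using (true; false)
open import Data.Empty using (⊥; ⊥-elim)
open import Data.List using (List; []; _∷_; _++_; [_]; last; map; upTo; applyUpTo; length)
open import Data.List.Properties using (map-applyUpTo; length-++)
open import Data.List.Membership.Propositional using (_∈_)
open import Data.List.Membership.Propositional.Properties using (∈-++⁺ˡ; ∈-++⁺ʳ; ∈-map⁻; ∈-upTo⁻)
open import Data.List.Relation.Binary.Disjoint.Propositional using (Disjoint)
open import Data.List.Relation.Binary.Subset.Propositional using (_⊆_)
open import Data.List.Relation.Binary.Permutation.Propositional using (↭-sym; ↭⇒↭ₛ)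
open import Data.List.Relation.Binary.Permutation.Propositional.Properties using (∈-resp-↭)
import Data.List.Relation.Binary.Permutation.Setoid.Properties as Permutationₛ
open import Data.List.Relation.Unary.All using (All; []; _∷_)
open import Data.List.Relation.Unary.All.Properties using (++⁻ˡ)
open import Data.List.Relation.Unary.AllPairs using (_∷_)
open import Data.List.Relation.Unary.Any using (here; there)
open import Data.List.Relation.Unary.Linked using (Linked; []; [-]; _∷_)
open import Data.List.Relation.Unary.Unique.Propositional using (Unique; [])
open import Data.List.Relation.Unary.Unique.Propositional.Properties
  using (map⁺; upTo⁺; Unique[x∷xs]⇒x∉xs)
open import Data.Maybe using (just; nothing)
open import Data.Maybe.Properties using (just-injective)
open import Data.Nat using (ℕ; zero; suc; _+_; _∸_; _≤_; _<_; _≟_; _≤?_; _≡ᵇ_; s≤s; z≤n; z<s)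
open import Data.Nat.Properties
open import Data.List.Membership.DecPropositional _≟_ using (_∈?_)
open import Data.Product using (∃; ∃₂; _×_; _,_; proj₁; proj₂)
open import Data.Sum as Sum using (_⊎_; inj₁; inj₂)
open import Data.Unit using (tt)
open import Data.Vec using (Vec; []; _∷_)
open import Data.Vec.Membership.Propositional using () renaming (_∈_ to _∈ᵥ_)
open import Data.Vec.Relation.Unary.Any using (here; there)
open import Function using (_∘_; id)
open import Relation.Nullary using (¬_; yes; no; contradiction)
open import Relation.Nullary.Decidable using (_×-dec_)
open import Relation.Binary.PropositionalEquality
  using (_≡_; _≢_; refl; sym; trans; cong; cong₂; subst; setoid; module ≡-Reasoning)

module _ {A : Set} where

  Unique-++⁻ˡ : ∀ (xs : List A) {ys} → Unique (xs ++ ys) → Unique xs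
  Unique-++⁻ˡ []       _            = []
  Unique-++⁻ˡ (x ∷ xs) (x∉ ∷ uniq) = ++⁻ˡ xs x∉ ∷ Unique-++⁻ˡ xs uniq

  Unique-++⁻ʳ : ∀ (xs : List A) {ys} → Unique (xs ++ ys) → Unique ys
  Unique-++⁻ʳ []       uniq       = uniq
  Unique-++⁻ʳ (x ∷ xs) (_ ∷ uniq) = Unique-++⁻ʳ xs uniq

  Unique-++⇒Disjoint : ∀ (xs : List A) {ys} → Unique (xs ++ ys) → Disjoint xs ys
  Unique-++⇒Disjoint (x ∷ xs) {ys} uniq (here refl , x∈ys) = Unique[x∷xs]⇒x∉xs uniq (∈-++⁺ʳ xs x∈ys)
  Unique-++⇒Disjoint (x ∷ xs)      (_ ∷ uniq) (there z∈xs , z∈ys) =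
    Unique-++⇒Disjoint xs uniq (z∈xs , z∈ys)

module _ {m : ℕ} where

  Cadet : Tree m → ℕ → ℕ → Set
  Cadet T x y = cadet T x ≡ just y

  infix 4 _⊑_
  data _⊑_ (s : Tree m) : Tree m → Set where
    ⊑-refl  : s ⊑ s
    ⊑-child : ∀ {x cs t} → t ∈ᵥ cs → s ⊑ t → s ⊑ node x cs

  ⊑-trans : ∀ {s t r} → s ⊑ t → t ⊑ r → s ⊑ r
  ⊑-trans s⊑t ⊑-refl            = s⊑t
  ⊑-trans s⊑t (⊑-child t∈ t⊑r) = ⊑-child t∈ (⊑-trans s⊑t t⊑r)

  labels-child : ∀ {k t} {ts : Vec (Tree m) k} → t ∈ᵥ ts → labels t ⊆ labelsV ts
  labels-child (here refl)          = ∈-++⁺ˡ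
  labels-child {ts = t ∷ _} (there t∈) = ∈-++⁺ʳ (labels t) ∘ labels-child t∈

  labels-⊑ : ∀ {s t} → s ⊑ t → labels s ⊆ labels t
  labels-⊑ ⊑-refl             = id
  labels-⊑ (⊑-child t∈ s⊑t) = there ∘ labels-child t∈ ∘ labels-⊑ s⊑t

  child-label-∈ : ∀ {x cs y ds t} → node x cs ⊑ t → node y ds ∈ᵥ cs → y ∈ labels t
  child-label-∈ x⊑t y∈ = labels-⊑ x⊑t (there (labels-child y∈ (here refl)))

  labels-child-⊑ : ∀ {x cs c z es} → node x cs ⊑ node z es → c ∈ᵥ cs → labels c ⊆ labelsV es
  labels-child-⊑ ⊑-refl             c∈ = labels-child c∈
  labels-child-⊑ (⊑-child t∈ x⊑t) c∈ = labels-child t∈ ∘ labels-⊑ x⊑t ∘ there ∘ labels-child c∈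

  Unique-child : ∀ {k t} {ts : Vec (Tree m) k} → Unique (labelsV ts) → t ∈ᵥ ts → Unique (labels t)
  Unique-child {t = t} uniq (here refl)            = Unique-++⁻ˡ (labels t) uniq
  Unique-child {ts = t′ ∷ _} uniq (there t∈) = Unique-child (Unique-++⁻ʳ (labels t′) uniq) t∈

  children-sharing-label : ∀ {k t t′ z} {ts : Vec (Tree m) k} → Unique (labelsV ts) →
    t ∈ᵥ ts → t′ ∈ᵥ ts → z ∈ labels t → z ∈ labels t′ → t ≡ t′
  children-sharing-label uniq (here refl) (here refl) _ _ = refl
  children-sharing-label {t = t} uniq (here refl) (there t′∈) z∈t z∈t′ =
    ⊥-elim (Unique-++⇒Disjoint (labels t) uniq (z∈t , labels-child t′∈ z∈t′))
  children-sharing-label {t′ = t′} uniq (there t∈) (here refl) z∈t z∈t′ =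
    ⊥-elim (Unique-++⇒Disjoint (labels t′) uniq (z∈t′ , labels-child t∈ z∈t))
  children-sharing-label {ts = t″ ∷ _} uniq (there t∈) (there t′∈) z∈t z∈t′ =
    children-sharing-label (Unique-++⁻ʳ (labels t″) uniq) t∈ t′∈ z∈t z∈t′

  rightmostNode-child : ∀ {k y} (ts : Vec (Tree m) k) → rightmostNode ts ≡ just y →
    ∃ λ ds → node y ds ∈ᵥ ts
  rightmostNode-child (t ∷ ts) eq with rightmostNode ts in eqts
  rightmostNode-child (t ∷ ts)          refl | just _  =
    let ds , y∈ = rightmostNode-child ts eqts in ds , there y∈
  rightmostNode-child (node _ ds ∷ ts) refl | nothing = ds , here refl

  cadet-child  : ∀ (T : Tree m) {x y} → Cadet T x y →
    ∃₂ λ cs ds → node x cs ⊑ T × node y ds ∈ᵥ cs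
  cadetᵥ-child : ∀ {k} (ts : Vec (Tree m) k) {x y} → cadetV ts x ≡ just y →
    ∃ λ t → t ∈ᵥ ts × ∃₂ λ cs ds → node x cs ⊑ t × node y ds ∈ᵥ cs
  cadet-child (node z es) {x} eq with z ≡ᵇ x | ≡ᵇ⇒≡ z x
  ... | true  | z≡x rewrite z≡x tt =
    let ds , y∈ = rightmostNode-child es eq in es , ds , ⊑-refl , y∈
  ... | false | _ =
    let t , t∈ , cs , ds , x⊑t , y∈ = cadetᵥ-child es eq in cs , ds , ⊑-child t∈ x⊑t , y∈
  cadetᵥ-child (t ∷ ts) {x} eq with cadet t x in eqt
  cadetᵥ-child (t ∷ ts) refl | just _  = t , here refl , cadet-child t eqt
  cadetᵥ-child (t ∷ ts) eq   | nothing =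
    let t′ , t′∈ , rest = cadetᵥ-child ts eq in t′ , there t′∈ , rest

  cadet-∈ : ∀ (T : Tree m) {x y} → Cadet T x y → y ∈ labels T
  cadet-∈ T eq = let _ , _ , x⊑T , y∈ = cadet-child T eq in child-label-∈ x⊑T y∈

  cadetᵥ-∈ : ∀ {k} (ts : Vec (Tree m) k) {x y} → cadetV ts x ≡ just y → y ∈ labelsV ts
  cadetᵥ-∈ ts eq =
    let t , t∈ , _ , _ , x⊑t , y∈ = cadetᵥ-child ts eq in labels-child t∈ (child-label-∈ x⊑t y∈)

  -- y is the root of one of the trees ts, whereas a cadet inside ts lies strictly below such a root.
  rightmostNode-cadetᵥ-disjoint : ∀ {k x y} (ts : Vec (Tree m) k) → Unique (labelsV ts) →
    rightmostNode ts ≡ just y → cadetV ts x ≡ just y → ⊥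
  rightmostNode-cadetᵥ-disjoint ts uniq eq eq′
    with ds , c∈ ← rightmostNode-child ts eq
       | t , t∈ , _ , _ , x⊑t , y∈ ← cadetᵥ-child ts eq′
    with refl ← children-sharing-label uniq c∈ t∈ (here refl) (child-label-∈ x⊑t y∈)
    = Unique[x∷xs]⇒x∉xs (Unique-child uniq c∈) (labels-child-⊑ x⊑t y∈ (here refl))

  cadet-injective  : ∀ (T : Tree m) {x x′ y} → Unique (labels T) →
    Cadet T x y → Cadet T x′ y → x ≡ x′
  cadetᵥ-injective : ∀ {k} (ts : Vec (Tree m) k) {x x′ y} → Unique (labelsV ts) →
    cadetV ts x ≡ just y → cadetV ts x′ ≡ just y → x ≡ x′
  cadet-injective (node z es) {x} {x′} (_ ∷ uniq) eq eq′
    with z ≡ᵇ x | ≡ᵇ⇒≡ z x | z ≡ᵇ x′ | ≡ᵇ⇒≡ z x′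
  ... | true  | z≡x | true  | z≡x′ = trans (sym (z≡x tt)) (z≡x′ tt)
  ... | true  | _   | false | _    = ⊥-elim (rightmostNode-cadetᵥ-disjoint es uniq eq eq′)
  ... | false | _   | true  | _    = ⊥-elim (rightmostNode-cadetᵥ-disjoint es uniq eq′ eq)
  ... | false | _   | false | _    = cadetᵥ-injective es uniq eq eq′
  cadetᵥ-injective (t ∷ ts) {x} {x′} uniq eq eq′ with cadet t x in eqt | cadet t x′ in eqt′
  cadetᵥ-injective (t ∷ ts) uniq refl refl | just _ | just _ =
    cadet-injective t (Unique-++⁻ˡ (labels t) uniq) eqt eqt′
  cadetᵥ-injective (t ∷ ts) uniq refl eq′  | just _ | nothing =
    ⊥-elim (Unique-++⇒Disjoint (labels t) uniq (cadet-∈ t eqt , cadetᵥ-∈ ts eq′))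
  cadetᵥ-injective (t ∷ ts) uniq eq refl   | nothing | just _ =
    ⊥-elim (Unique-++⇒Disjoint (labels t) uniq (cadet-∈ t eqt′ , cadetᵥ-∈ ts eq))
  cadetᵥ-injective (t ∷ ts) uniq eq eq′    | nothing | nothing =
    cadetᵥ-injective ts (Unique-++⁻ʳ (labels t) uniq) eq eq′

  subtreeAt  : Tree m → ℕ → Tree m
  subtreeAtᵥ : ∀ {k} → Vec (Tree m) k → ℕ → Tree m
  subtreeAt leaf        x = leaf
  subtreeAt (node z cs) x with z ≟ x
  ... | yes _ = node z cs
  ... | no  _ = subtreeAtᵥ cs x
  subtreeAtᵥ []       x = leaf
  subtreeAtᵥ (t ∷ ts) x with x ∈? labels t
  ... | yes _ = subtreeAt t x
  ... | no  _ = subtreeAtᵥ ts x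

  subtreeAt-⊑  : ∀ (T : Tree m) {x cs} → Unique (labels T) → node x cs ⊑ T → subtreeAt T x ≡ node x cs
  subtreeAtᵥ-⊑ : ∀ {k} (ts : Vec (Tree m) k) {t x cs} → Unique (labelsV ts) →
    t ∈ᵥ ts → node x cs ⊑ t → subtreeAtᵥ ts x ≡ node x cs
  subtreeAt-⊑ (node z cs) _ ⊑-refl with z ≟ z
  ... | yes _   = refl
  ... | no z≢z = contradiction refl z≢z
  subtreeAt-⊑ (node z cs) {x} uniq (⊑-child t∈ x⊑t) with z ≟ x | uniq
  ... | yes refl | _         =
    ⊥-elim (Unique[x∷xs]⇒x∉xs uniq (labels-child t∈ (labels-⊑ x⊑t (here refl))))
  ... | no _     | _ ∷ uniq′ = subtreeAtᵥ-⊑ cs uniq′ t∈ x⊑t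
  subtreeAtᵥ-⊑ (t ∷ ts) {x = x} uniq (here refl) x⊑t with x ∈? labels t
  ... | yes _   = subtreeAt-⊑ t (Unique-++⁻ˡ (labels t) uniq) x⊑t
  ... | no x∉t = contradiction (labels-⊑ x⊑t (here refl)) x∉t
  subtreeAtᵥ-⊑ (t ∷ ts) {x = x} uniq (there t′∈) x⊑t′ with x ∈? labels t
  ... | yes x∈t =
    ⊥-elim (Unique-++⇒Disjoint (labels t) uniq (x∈t , labels-child t′∈ (labels-⊑ x⊑t′ (here refl))))
  ... | no _    = subtreeAtᵥ-⊑ ts (Unique-++⁻ʳ (labels t) uniq) t′∈ x⊑t′

  size : Tree m → ℕ
  size = length ∘ labels

  size-child : ∀ {k t} {ts : Vec (Tree m) k} → t ∈ᵥ ts → size t ≤ length (labelsV ts)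
  size-child {t = t} {ts = _ ∷ ts} (here refl) rewrite length-++ (labels t) {labelsV ts} = m≤m+n _ _
  size-child {ts = t′ ∷ ts} (there t∈) rewrite length-++ (labels t′) {labelsV ts} =
    ≤-trans (size-child t∈) (m≤n+m _ _)

  cadet-size< : ∀ (T : Tree m) {x y} → Unique (labels T) → Cadet T x y →
    size (subtreeAt T y) < size (subtreeAt T x)
  cadet-size< T uniq eq with cs , ds , x⊑T , y∈ ← cadet-child T eq
    rewrite subtreeAt-⊑ T uniq x⊑T | subtreeAt-⊑ T uniq (⊑-trans (⊑-child y∈ ⊑-refl) x⊑T)
    = s≤s (size-child y∈)

labels-unique : ∀ {m n} {T : Tree m} → LabelledBy n T → Unique (labels T)
labels-unique {n = n} lb =
  Permutationₛ.Unique-resp-↭ (setoid ℕ) (↭⇒↭ₛ (↭-sym lb)) (map⁺ suc-injective (upTo⁺ n))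

labels-inRange : ∀ {m n} {T : Tree m} → LabelledBy n T → ∀ {x} → x ∈ labels T → InRange n x
labels-inRange lb x∈ with y , y∈ , refl ← ∈-map⁻ suc (∈-resp-↭ lb x∈) = s≤s z≤n , ∈-upTo⁻ y∈

window : (ℕ → ℕ) → ℕ → ℕ → List ℕ
window u i zero    = []
window u i (suc k) = u i ∷ window u (suc i) k

applyUpTo≡window : ∀ {f u} i k → (∀ r → f r ≡ u (i + r)) → applyUpTo f k ≡ window u i k
applyUpTo≡window         i zero    _  = refl
applyUpTo≡window {u = u} i (suc k) f≗ =
  cong₂ _∷_ (trans (f≗ 0) (cong u (+-identityʳ i)))
            (applyUpTo≡window (suc i) k (λ r → trans (f≗ (suc r)) (cong u (+-suc i r))))

seg≡window : ∀ u i j → seg u i j ≡ window u i (suc j ∸ i)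
seg≡window u i j = begin
  map u (map (i +_) (upTo (suc j ∸ i)))  ≡⟨ cong (map u) (map-applyUpTo id (i +_) (suc j ∸ i)) ⟩
  map u (applyUpTo (i +_) (suc j ∸ i))   ≡⟨ map-applyUpTo (i +_) u (suc j ∸ i) ⟩
  applyUpTo (u ∘ (i +_)) (suc j ∸ i)     ≡⟨ applyUpTo≡window i (suc j ∸ i) (λ _ → refl) ⟩
  window u i (suc j ∸ i)                 ∎
  where open ≡-Reasoning

window-snoc : ∀ u i k → window u i k ++ [ u (i + k) ] ≡ window u i (suc k)
window-snoc u i zero    = cong [_] (cong u (+-identityʳ i))
window-snoc u i (suc k) = cong (u i ∷_) (trans (cong (λ r → window u (suc i) k ++ [ u r ]) (+-suc i k))
                                               (window-snoc u (suc i) k))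

window-last : ∀ u i k → last (window u i (suc k)) ≡ just (u (i + k))
window-last u i zero    = cong (just ∘ u) (sym (+-identityʳ i))
window-last u i (suc k) = trans (window-last u (suc i) k) (cong (just ∘ u) (sym (+-suc i k)))

AllOn : (ℕ → Set) → (ℕ → ℕ) → ℕ → ℕ → Set
AllOn P u i j = ∀ {p} → i ≤ p → p < j → P (u p)

LinkedOn : (ℕ → ℕ → Set) → (ℕ → ℕ) → ℕ → ℕ → Set
LinkedOn R u i j = ∀ {p} → i ≤ p → suc p < j → R (u p) (u (suc p))

All-window⁺ : ∀ {P} u i k → AllOn P u i (i + k) → All P (window u i k)
All-window⁺ u i zero    _   = []
All-window⁺ u i (suc k) all =
  all ≤-refl (m<m+n i z<s) ∷
  All-window⁺ u (suc i) k (λ {p} i<p p<j → all (<⇒≤ i<p) (subst (p <_) (sym (+-suc i k)) p<j))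

Linked-window⁺ : ∀ {R} u i k → LinkedOn R u i (i + k) → Linked R (window u i k)
Linked-window⁺ u i zero          _     = []
Linked-window⁺ u i (suc zero)    _     = [-]
Linked-window⁺ u i (suc (suc k)) links =
  links ≤-refl (subst (suc i <_) (sym (+-suc i (suc k))) (s≤s (m<m+n i z<s)))
  ∷ Linked-window⁺ u (suc i) (suc k)
      (λ {p} i<p p<j → links (<⇒≤ i<p) (subst (suc p <_) (sym (+-suc i (suc k))) p<j))

Linked-window⁻ : ∀ {R} u i k → Linked R (window u i k) → LinkedOn R u i (i + k)
Linked-window⁻ u i (suc (suc k)) (r ∷ linked) {p} i≤p p<j with m≤n⇒m<n∨m≡n i≤p
... | inj₂ refl = r
... | inj₁ i<p  = Linked-window⁻ u (suc i) (suc k) linked i<p (subst (suc p <_) (+-suc i (suc k)) p<j)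
Linked-window⁻ u i (suc zero) _ {p} i≤p p<j =
  contradiction (subst (_≤ suc p) (+-comm 1 i) (s≤s i≤p)) (<⇒≱ p<j)
Linked-window⁻ u i zero       _ {p} i≤p p<j =
  contradiction (subst (_≤ suc p) (sym (+-identityʳ i)) (≤-trans i≤p (n≤1+n p))) (<⇒≱ p<j)

InjectiveOn : (ℕ → ℕ) → ℕ → ℕ → Set
InjectiveOn u i j = ∀ {p q} → i ≤ p → p < q → q < j → u p ≢ u q

steps-< : ∀ (f : ℕ → ℕ) {i j} → (∀ {p} → i ≤ p → suc p < j → f (suc p) < f p) →
  ∀ {p q} → i ≤ p → p < q → q < j → f q < f p
steps-< f step {p} {suc q} i≤p (s≤s p≤q) q<j with m≤n⇒m<n∨m≡n p≤q
... | inj₂ refl = step i≤p q<j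
... | inj₁ p<q  =
  <-trans (step (≤-trans i≤p (<⇒≤ p<q)) q<j) (steps-< f step i≤p p<q (<-trans (n<1+n q) q<j))

-- Walking down a chain of cadets strictly shrinks the subtree below the current node.
LinkedOn-cadet⇒injective : ∀ {m u i j} (T : Tree m) → Unique (labels T) →
  LinkedOn (Cadet T) u i j → InjectiveOn u i j
LinkedOn-cadet⇒injective {u = u} T uniq chain i≤p p<q q<j up≡uq =
  <-irrefl (cong (size ∘ subtreeAt T) (sym up≡uq))
    (steps-< (size ∘ subtreeAt T ∘ u) (λ i≤p sp<j → cadet-size< T uniq (chain i≤p sp<j)) i≤p p<q q<j)

module Compatibility {m} (S : Family) (T : Tree m) (u : ℕ → ℕ) where

  lsibSum : ℕ → ℕ → ℕ
  lsibSum i zero    = 0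
  lsibSum i (suc k) = lsib T (u i) + lsibSum (suc i) k

  lsibSum-+ : ∀ i k l → lsibSum i (k + l) ≡ lsibSum i k + lsibSum (i + k) l
  lsibSum-+ i zero    l rewrite +-identityʳ i = refl
  lsibSum-+ i (suc k) l rewrite lsibSum-+ (suc i) k l | +-suc i k =
    sym (+-assoc (lsib T (u i)) (lsibSum (suc i) k) (lsibSum (suc (i + k)) l))

  lsibSum-split : ∀ {p j q} → p ≤ j → j ≤ q →
    lsibSum (suc p) (q ∸ p) ≡ lsibSum (suc p) (j ∸ p) + lsibSum (suc j) (q ∸ j)
  lsibSum-split {p} {j} {q} p≤j j≤q = begin
    lsibSum (suc p) (q ∸ p)
      ≡⟨ cong (lsibSum (suc p)) q∸p≡ ⟩
    lsibSum (suc p) (j ∸ p + (q ∸ j))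
      ≡⟨ lsibSum-+ (suc p) (j ∸ p) (q ∸ j) ⟩
    lsibSum (suc p) (j ∸ p) + lsibSum (suc (p + (j ∸ p))) (q ∸ j)
      ≡⟨ cong (λ r → lsibSum (suc p) (j ∸ p) + lsibSum (suc r) (q ∸ j)) (m+[n∸m]≡n p≤j) ⟩
    lsibSum (suc p) (j ∸ p) + lsibSum (suc j) (q ∸ j)
      ∎
    where
    open ≡-Reasoning
    q∸p≡ : q ∸ p ≡ j ∸ p + (q ∸ j)
    q∸p≡ = trans (cong (_∸ p) (sym (m+[n∸m]≡n j≤q))) (+-∸-comm (q ∸ j) p≤j)

  -- The condition imposed on the pair (v_i, v_j) = (u p, u q) of an S-cadet sequence.
  Compatible : ℕ → ℕ → Set
  Compatible p q = ¬ SMinus S (u p) (u q) (lsibSum (suc p) (q ∸ p))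

  AllCompatible : ℕ → ℕ → Set
  AllCompatible i j = ∀ {p q} → i ≤ p → p < q → q < j → Compatible p q

  AllCompatible-mono : ∀ {i i′ j j′} → i ≤ i′ → j′ ≤ j → AllCompatible i j → AllCompatible i′ j′
  AllCompatible-mono i≤i′ j′≤j ok i′≤p p<q q<j′ = ok (≤-trans i≤i′ i′≤p) p<q (<-≤-trans q<j′ j′≤j)

  goodFrom-window⁻ : ∀ {v} acc j k → goodFrom S T v acc (window u j k) →
    ∀ {d} → d < k → ¬ SMinus S v (u (j + d)) (acc + lsibSum j (suc d))
  goodFrom-window⁻ acc j (suc k) (ok , _) {zero} _
    rewrite +-identityʳ j | +-identityʳ (lsib T (u j)) = ok
  goodFrom-window⁻ acc j (suc k) (_ , ok) {suc d} (s≤s d<k)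
    rewrite +-suc j d | sym (+-assoc acc (lsib T (u j)) (lsibSum (suc j) (suc d))) =
    goodFrom-window⁻ (acc + lsib T (u j)) (suc j) k ok d<k

  goodFrom-window⁺ : ∀ {v} acc j k →
    (∀ {d} → d < k → ¬ SMinus S v (u (j + d)) (acc + lsibSum j (suc d))) →
    goodFrom S T v acc (window u j k)
  goodFrom-window⁺ acc j zero    _  = tt
  goodFrom-window⁺ {v} acc j (suc k) ok = head , goodFrom-window⁺ (acc + lsib T (u j)) (suc j) k tail
    where
    head : ¬ SMinus S v (u j) (acc + lsib T (u j))
    head with ok z<s
    ... | ok₀ rewrite +-identityʳ j | +-identityʳ (lsib T (u j)) = ok₀
    tail : ∀ {d} → d < k → ¬ SMinus S v (u (suc j + d)) (acc + lsib T (u j) + lsibSum (suc j) (suc d))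
    tail {d} d<k with ok (s≤s d<k)
    ... | okₛ rewrite +-suc j d | sym (+-assoc acc (lsib T (u j)) (lsibSum (suc j) (suc d))) = okₛ

  suc[m+n]∸m≡suc[n] : ∀ i d → suc (i + d) ∸ i ≡ suc d
  suc[m+n]∸m≡suc[n] i d = trans (+-∸-assoc 1 (m≤m+n i d)) (cong suc (m+n∸m≡n i d))

  goodFrom-head⁻ : ∀ i k → goodFrom S T (u i) 0 (window u (suc i) k) →
    ∀ {q} → i < q → q < suc i + k → Compatible i q
  goodFrom-head⁻ i k ok i<q q<j with d , refl ← m≤n⇒∃[o]m+o≡n i<q
    rewrite suc[m+n]∸m≡suc[n] i d = goodFrom-window⁻ 0 (suc i) k ok (+-cancelˡ-< (suc i) d k q<j)

  goodFrom-head⁺ : ∀ i k → (∀ {q} → i < q → q < suc i + k → Compatible i q) →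
    goodFrom S T (u i) 0 (window u (suc i) k)
  goodFrom-head⁺ i k ok = goodFrom-window⁺ 0 (suc i) k compatible
    where
    compatible : ∀ {d} → d < k → ¬ SMinus S (u i) (u (suc i + d)) (lsibSum (suc i) (suc d))
    compatible {d} d<k with ok (s≤s (m≤m+n i d)) (+-monoʳ-< (suc i) d<k)
    ... | okₙ rewrite suc[m+n]∸m≡suc[n] i d = okₙ

  SCond-window⁻ : ∀ i k → SCond S T (window u i k) → AllCompatible i (i + k)
  SCond-window⁻ i zero _ {p} {q} i≤p p<q q<j =
    contradiction (subst (_≤ q) (sym (+-identityʳ i)) (≤-trans i≤p (<⇒≤ p<q))) (<⇒≱ q<j)
  SCond-window⁻ i (suc k) (head , rest) {p} {q} i≤p p<q q<j with m≤n⇒m<n∨m≡n i≤p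
  ... | inj₂ refl = goodFrom-head⁻ i k head p<q (subst (q <_) (+-suc i k) q<j)
  ... | inj₁ i<p  = SCond-window⁻ (suc i) k rest i<p p<q (subst (q <_) (+-suc i k) q<j)

  SCond-window⁺ : ∀ i k → AllCompatible i (i + k) → SCond S T (window u i k)
  SCond-window⁺ i zero    _  = tt
  SCond-window⁺ i (suc k) ok =
    goodFrom-head⁺ i k (λ {q} i<q q<j → ok ≤-refl i<q (subst (q <_) (sym (+-suc i k)) q<j)) ,
    SCond-window⁺ (suc i) k (λ {_} {q} i<p p<q q<j → ok (<⇒≤ i<p) p<q (subst (q <_) (sym (+-suc i k)) q<j))

  window-isSCadetSeq : ∀ i k → AllOn (_∈ labels T) u i (i + suc k) → LinkedOn (Cadet T) u i (i + suc k) →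
    AllCompatible i (i + suc k) → IsSCadetSeq S T (window u i (suc k))
  window-isSCadetSeq i k labelled linked ok =
    ((λ ()) , All-window⁺ u i (suc k) labelled , Linked-window⁺ u i (suc k) linked) ,
    SCond-window⁺ i (suc k) ok

  Compatible-trans : ∀ {n p j q} → AlmostTransitive n S → p < j → j < q →
    InRange n (u p) → InRange n (u j) → InRange n (u q) → u p ≢ u j → u j ≢ u q → u p ≢ u q →
    u p ≢ 1 → u q ≢ 1 → Compatible p j → Compatible j q → Compatible p q
  Compatible-trans at p<j j<q rp rj rq p≢j j≢q p≢q p≢1 q≢1 okₚⱼ okⱼq
    rewrite lsibSum-split (<⇒≤ p<j) (<⇒≤ j<q) = at _ _ _ rp rj rq p≢j j≢q p≢q p≢1 q≢1 _ _ okₚⱼ okⱼq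

  -- A pair straddling the overlap [k, j) is joined through its first position k.
  AllCompatible-glue : ∀ {n i k j l} → AlmostTransitive n S →
    AllOn (InRange n) u i l → InjectiveOn u i l → AllOn (_≢ 1) u i k → AllOn (_≢ 1) u j l → k < j →
    AllCompatible i j → AllCompatible k l → AllCompatible i l
  AllCompatible-glue {k = k} {j} at inRange injective ≢1ˡ ≢1ʳ k<j okˡ okʳ {p} {q} i≤p p<q q<l
    with q <? j | k ≤? p
  ... | yes q<j | _       = okˡ i≤p p<q q<j
  ... | no q≮j  | yes k≤p = okʳ k≤p p<q q<l
  ... | no q≮j  | no k≰p  =
    Compatible-trans at p<k k<q (inRange i≤p p<l) (inRange i≤k k<l) (inRange (≤-trans i≤p (<⇒≤ p<q)) q<l)
      (injective i≤p p<k k<l) (injective i≤k k<q q<l) (injective i≤p p<q q<l)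
      (≢1ˡ i≤p p<k) (≢1ʳ j≤q q<l) (okˡ i≤p p<k k<j) (okʳ ≤-refl k<q q<l)
    where
    p<k = ≰⇒> k≰p
    j≤q = ≮⇒≥ q≮j
    k<q = <-≤-trans k<j j≤q
    k<l = <-trans k<q q<l
    p<l = <-trans p<k k<l
    i≤k = ≤-trans i≤p (<⇒≤ p<k)

module _ {m} {S : Family} {T : Tree m} where

  IsMaxSCadetSeq⇒¬extend-last : ∀ {vs l v} → IsMaxSCadetSeq S T vs → last vs ≡ just l → Cadet T l v →
    ¬ IsSCadetSeq S T (vs ++ [ v ])
  IsMaxSCadetSeq⇒¬extend-last (_ , _ , atEnd) lastIsL l→v with atEnd _ lastIsL
  ... | inj₁ noCadet = contradiction (trans (sym noCadet) l→v) λ ()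
  ... | inj₂ (v′ , l→v′ , ¬extended) rewrite just-injective (trans (sym l→v) l→v′) = ¬extended

  IsMaxSCadetSeq⇒¬extend-head : ∀ {x vs w} → Unique (labels T) →
    IsMaxSCadetSeq S T (x ∷ vs) → Cadet T w x → ¬ IsSCadetSeq S T (w ∷ x ∷ vs)
  IsMaxSCadetSeq⇒¬extend-head uniq (_ , atStart , _) w→x with atStart _ refl
  ... | inj₁ noParent = contradiction w→x (noParent _)
  ... | inj₂ (w′ , w′→x , ¬extended) rewrite cadet-injective T uniq w→x w′→x = ¬extended

module Overlap {n m} {S : Family} (at : AlmostTransitive n S) {T : Tree m} (lb : LabelledBy n T)
  (a′ b c′ : ℕ) {u : ℕ → ℕ} (u∈T : ∀ p → 1 ≤ p → p ≤ suc a′ + b + suc c′ → u p ∈ labels T)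
  (max₁ : IsMaxSCadetSeq S T (seg u 1 (suc a′ + b)))
  (max₂ : IsMaxSCadetSeq S T (seg u (suc a′) (suc a′ + b + suc c′))) where

  open Compatibility S T u

  a N : ℕ
  a = suc a′
  N = a + b + suc c′

  a+[b+c]≡N : a + suc (b + suc c′) ≡ suc N
  a+[b+c]≡N = trans (+-suc a (b + suc c′)) (cong suc (sym (+-assoc a b (suc c′))))

  max₁ʷ : IsMaxSCadetSeq S T (window u 1 (a + b))
  max₁ʷ = subst (IsMaxSCadetSeq S T) (seg≡window u 1 (a + b)) max₁

  max₂ʷ : IsMaxSCadetSeq S T (window u a (suc (b + suc c′)))
  max₂ʷ = subst (IsMaxSCadetSeq S T)
    (trans (seg≡window u a N) (cong (window u a) (trans (cong (_∸ a) (sym a+[b+c]≡N)) (m+n∸m≡n a _))))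
    max₂

  first-compatible : AllCompatible 1 (suc (a + b))
  first-compatible = SCond-window⁻ 1 (a + b) (proj₂ (proj₁ max₁ʷ))

  second-compatible : AllCompatible a (suc N)
  second-compatible = subst (AllCompatible a) a+[b+c]≡N (SCond-window⁻ a _ (proj₂ (proj₁ max₂ʷ)))

  chain : LinkedOn (Cadet T) u 1 (suc N)
  chain {p} 1≤p p<N with suc p <? suc (a + b)
  ... | yes p<a+b = Linked-window⁻ u 1 (a + b) (proj₂ (proj₂ (proj₁ (proj₁ max₁ʷ)))) 1≤p p<a+b
  ... | no  p≮a+b = Linked-window⁻ u a _ (proj₂ (proj₂ (proj₁ (proj₁ max₂ʷ))))
                      (≤-trans (m≤m+n a b) (≤-pred (≮⇒≥ p≮a+b))) (subst (suc p <_) (sym a+[b+c]≡N) p<N)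

  labelled : AllOn (_∈ labels T) u 1 (suc N)
  labelled 1≤p p<N = u∈T _ 1≤p (≤-pred p<N)

  inRange : AllOn (InRange n) u 1 (suc N)
  inRange 1≤p p<N = labels-inRange lb (labelled 1≤p p<N)

  injective : InjectiveOn u 1 (suc N)
  injective = LinkedOn-cadet⇒injective T (labels-unique lb) chain

  a+b<N : a + b < N
  a+b<N = m<m+n (a + b) z<s

  extend-first : AllOn (_≢ 1) u 1 a → u (suc (a + b)) ≢ 1 → IsSCadetSeq S T (window u 1 (suc (a + b)))
  extend-first ≢1ˡ uQ≢1 =
    window-isSCadetSeq 1 (a + b) (λ 1≤p p<l → labelled 1≤p (<-≤-trans p<l l≤sucN))
      (λ 1≤p p<l → chain 1≤p (<-≤-trans p<l l≤sucN))
      (AllCompatible-glue at (λ 1≤p p<l → inRange 1≤p (<-≤-trans p<l l≤sucN))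
        (λ 1≤p p<q q<l → injective 1≤p p<q (<-≤-trans q<l l≤sucN)) ≢1ˡ
        (λ Q≤q q<l → subst (λ q → u q ≢ 1) (≤-antisym Q≤q (≤-pred q<l)) uQ≢1)
        (s≤s (m≤m+n a b)) first-compatible (AllCompatible-mono ≤-refl l≤sucN second-compatible))
    where
    l≤sucN : suc (suc (a + b)) ≤ suc N
    l≤sucN = s≤s a+b<N

  first-unextendable : ¬ IsSCadetSeq S T (window u 1 (suc (a + b)))
  first-unextendable = subst (¬_ ∘ IsSCadetSeq S T) (window-snoc u 1 (a + b))
    (IsMaxSCadetSeq⇒¬extend-last max₁ʷ (window-last u 1 (a′ + b)) (chain (s≤s z≤n) (s≤s a+b<N)))

  extend-second : ∀ {p₀} → 1 ≤ p₀ → p₀ < a′ → u p₀ ≡ 1 → u a′ ≢ 1 →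
    IsSCadetSeq S T (window u a′ (suc (suc (b + suc c′))))
  extend-second {p₀} 1≤p₀ p₀<a′ up₀≡1 ua′≢1 =
    window-isSCadetSeq a′ _ (λ {p} a′≤p p<l → labelled (≤-trans 1≤a′ a′≤p) (subst (p <_) l≡sucN p<l))
      (λ {p} a′≤p p<l → chain (≤-trans 1≤a′ a′≤p) (subst (suc p <_) l≡sucN p<l))
      (subst (AllCompatible a′) (sym l≡sucN)
        (AllCompatible-glue at (inRange ∘ ≤-trans 1≤a′) (injective ∘ ≤-trans 1≤a′)
          (λ a′≤p p<a → subst (λ p → u p ≢ 1) (≤-antisym a′≤p (≤-pred p<a)) ua′≢1)
          (λ {q} Q≤q q<l uq≡1 → injective 1≤p₀ (p₀<q Q≤q) q<l (trans up₀≡1 (sym uq≡1)))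
          (s≤s (m≤m+n a b)) (AllCompatible-mono 1≤a′ ≤-refl first-compatible) second-compatible))
    where
    1≤a′ : 1 ≤ a′
    1≤a′ = ≤-trans 1≤p₀ (<⇒≤ p₀<a′)
    l≡sucN : a′ + suc (suc (b + suc c′)) ≡ suc N
    l≡sucN = trans (+-suc a′ _) a+[b+c]≡N
    p₀<q : ∀ {q} → suc (a + b) ≤ q → p₀ < q
    p₀<q Q≤q = <-≤-trans (<-trans p₀<a′ (s≤s (m≤m+n a′ b))) (≤-trans (n≤1+n _) Q≤q)

  second-unextendable : 1 ≤ a′ → ¬ IsSCadetSeq S T (window u a′ (suc (suc (b + suc c′))))
  second-unextendable 1≤a′ =
    IsMaxSCadetSeq⇒¬extend-head (labels-unique lb) max₂ʷ
      (chain 1≤a′ (s≤s (≤-trans (m≤m+n a b) (<⇒≤ a+b<N))))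

  one-after-overlap : AllOn (_≢ 1) u 1 a → u (suc (a + b)) ≡ 1
  one-after-overlap ≢1ˡ with u (suc (a + b)) ≟ 1
  ... | yes uQ≡1 = uQ≡1
  ... | no  uQ≢1 = ⊥-elim (first-unextendable (extend-first ≢1ˡ uQ≢1))

  one-before-overlap : ∀ {p₀} → 1 ≤ p₀ → p₀ < a → u p₀ ≡ 1 → 1 < a × u a′ ≡ 1
  one-before-overlap {p₀} 1≤p₀ p₀<a up₀≡1 with u a′ ≟ 1
  ... | yes ua′≡1 = ≤-trans (s≤s 1≤p₀) p₀<a , ua′≡1
  ... | no  ua′≢1 =
    ⊥-elim (second-unextendable (≤-trans 1≤p₀ (<⇒≤ p₀<a′)) (extend-second 1≤p₀ p₀<a′ up₀≡1 ua′≢1))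
    where
    p₀<a′ : p₀ < a′
    p₀<a′ = ≤∧≢⇒< (≤-pred p₀<a) λ { refl → ua′≢1 up₀≡1 }

  one-next-to-overlap : (1 < a × u a′ ≡ 1) ⊎ u (suc (a + b)) ≡ 1
  one-next-to-overlap with anyUpTo? (λ p → (1 ≤? p) ×-dec (u p ≟ 1)) a
  ... | yes (p₀ , p₀<a , 1≤p₀ , up₀≡1) = inj₁ (one-before-overlap 1≤p₀ p₀<a up₀≡1)
  ... | no ∄                           =
    inj₂ (one-after-overlap λ 1≤p p<a up≡1 → ∄ (_ , p<a , 1≤p , up≡1))

corollary4p5 : (n : ℕ) (S : Family) → AlmostTransitive n S →
    (T : Tree (mOf n S)) → LabelledBy n T →
    (a b c : ℕ) → 1 ≤ a → 1 ≤ b → 1 ≤ c →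
    (u : ℕ → ℕ) → (∀ p → 1 ≤ p → p ≤ a + b + c → u p ∈ labels T) →
    IsMaxSCadetSeq S T (seg u 1 (a + b)) →
    IsMaxSCadetSeq S T (seg u a (a + b + c)) →
    ((1 < a) × (u (a ∸ 1) ≡ 1)) ⊎ ((a ≡ 1) × (cadet T 1 ≡ just (u 1))) ⊎ (u (a + b + 1) ≡ 1)
corollary4p5 n S at T lb (suc a′) b (suc c′) _ _ _ u u∈T max₁ max₂ =
  Sum.map₂ (inj₂ ∘ subst (λ q → u q ≡ 1) (+-comm 1 (suc a′ + b))) one-next-to-overlap
  where open Overlap at lb a′ b c′ u∈T max₁ max₂
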